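{- Let $S$ be a numerical semigroup with multiplicity $m$, embedding dimension $\nu$ and conductor $f+1=qm-\rho$ for some $q\in\mathbb N$, $0\le\rho\le m-1$. Suppose that $m-\nu>\frac{\alpha(\alpha-1)}{2}$ for some integer $\alpha$ with $1<\alpha<m-1$. If $\left(2+\frac{\alpha-3}{q}\right)\nu\ge m$, then $S$ satisfies Wilf's Conjecture, i.e. $f+1\le\nu n$.
   Context: A numerical semigroup is a submonoid of $(\mathbb N,+)$ with finite complement. $f$ is its Frobenius number (largest integer not in $S$), $m$ its smallest nonzero element, $\nu$ its minimal number of generators, and $n=|\{s\in S: s<f\}|$. -}

module Defs where

open import Data.Nat using (ℕ; zero; suc; _+_; _*_; _∸_; _≤_; _<_; _≡ᵇ_; _<ᵇ_)
open import Data.Bool using (Bool; true; false; _∧_; not)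
open import Data.List using (List; length; filter; upTo)
open import Data.Bool.ListAction using (any)
open import Data.Product using (∃)
open import Relation.Binary.PropositionalEquality using (_≡_)
open import Relation.Nullary.Decidable using (does)
open import Data.Bool.Properties using (T?)

record NumericalSemigroup : Set where
  field
    mem      : ℕ → Bool
    zero∈    : mem 0 ≡ true
    closed   : ∀ a b → mem a ≡ true → mem b ≡ true → mem (a + b) ≡ true
    cofinite : ∃ λ N → ∀ k → N ≤ k → mem k ≡ true
open NumericalSemigroup public

IsFrobenius : NumericalSemigroup → ℕ → Set
IsFrobenius S f = mem S f ≡ false × (∀ k → f < k → mem S k ≡ true)
  where open import Data.Product using (_×_)

IsMultiplicity : NumericalSemigroup → ℕ → Set
IsMultiplicity S m = 0 < m × mem S m ≡ true × (∀ k → 0 < k → k < m → mem S k ≡ false)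
  where open import Data.Product using (_×_)

isMinGen : NumericalSemigroup → ℕ → Bool
isMinGen S s = mem S s ∧ not (s ≡ᵇ 0)
             ∧ not (any (λ a → not (a ≡ᵇ 0) ∧ mem S a ∧ mem S (s ∸ a)) (upTo s))

-- Embedding dimension ν (number of minimal generators). Every minimal generator
-- is ≤ f + m (any s > f + m equals m + (s - m) with s - m > f), so counting
-- within [0, f + m] counts all of them.
embDim : (S : NumericalSemigroup) (f m : ℕ) → ℕ
embDim S f m = length (filter (λ s → T? (isMinGen S s)) (upTo (suc (f + m))))

leftCount : (S : NumericalSemigroup) (f : ℕ) → ℕ
leftCount S f = length (filter (λ s → T? (mem S s)) (upTo f))

-- Let Ap be the Apéry set of S with respect to m without 0, and k the number of its elements
-- below f. Every nonzero residue mod m is represented in Ap, and an element of Ap is either a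
-- minimal generator other than m or a sum a + b of two elements of Ap below f. Counting unordered
-- pairs gives m − ν ≤ k(k+1)/2, so m − ν > α(α−1)/2 forces α ≤ k; as α ≥ 2 it also leaves two
-- elements of Ap that are not generators, and their decompositions yield a ≠ b in Ap with
-- a + b ≤ f + m. Below f, S contains the q multiples of m, the k elements of Ap, and at least
-- q − 3 of the elements a + im, b + jm (i, j ≥ 1), so n ≥ 2q + k − 3 ≥ 2q + α − 3, and the
-- hypothesis (2q + α − 3)ν ≥ qm gives f + 1 ≤ qm ≤ νn.
module Submission where

open import Defs
open import Data.Bool using (Bool; true; false; _∧_; not; if_then_else_)
open import Data.Bool.ListAction using (any)
open import Data.Bool.Properties using (T?; T-≡; not-injective; ∧-zeroʳ; ∧-assoc; ∧-idem; ∧-comm)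
open import Data.List using (_++_; [_]; length; filter; upTo)
open import Data.List.Membership.Propositional using (find)
open import Data.List.Membership.Propositional.Properties using (∈-upTo⁻)
open import Data.List.Properties using (upTo-∷ʳ; filter-++; length-++)
open import Data.List.Relation.Unary.Any.Properties using (any⁻)
open import Data.Nat
open import Data.Nat.DivMod
open import Data.Nat.Properties
open import Data.Nat.Tactic.RingSolver using (solve-∀)
open import Data.Product using (∃; ∃₂; _×_; _,_; proj₁; proj₂)
open import Data.Sum using (_⊎_; inj₁; inj₂)
open import Function using (Equivalence; _∘_; _∘′_)
open import Relation.Binary.Definitions using (tri<; tri≈; tri>)
open import Relation.Binary.PropositionalEquality hiding ([_])
open import Relation.Nullary using (yes; no; contradiction; does)
open import Relation.Nullary.Decidable using (dec-true; dec-false)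

count : (ℕ → Bool) → ℕ → ℕ
count p zero    = 0
count p (suc n) = if p n then suc (count p n) else count p n

length-filter-upTo : ∀ (p : ℕ → Bool) n → length (filter (λ x → T? (p x)) (upTo n)) ≡ count p n
length-filter-upTo p zero = refl
length-filter-upTo p (suc n) = begin
  length (filter P? (upTo (suc n)))               ≡⟨ cong (length ∘′ filter P?) (upTo-∷ʳ n) ⟨
  length (filter P? (upTo n ++ [ n ]))            ≡⟨ cong length (filter-++ P? (upTo n) [ n ]) ⟩
  length (filter P? (upTo n) ++ filter P? [ n ])  ≡⟨ length-++ (filter P? (upTo n)) ⟩
  length (filter P? (upTo n)) + length (filter P? [ n ])
    ≡⟨ cong (_+ length (filter P? [ n ])) (length-filter-upTo p n) ⟩
  count p n + length (filter P? [ n ])            ≡⟨ last ⟩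
  count p (suc n) ∎
  where
  open ≡-Reasoning
  P? = λ x → T? (p x)
  last : count p n + length (filter P? [ n ]) ≡ count p (suc n)
  last with p n
  ... | true  = +-comm (count p n) 1
  ... | false = +-identityʳ (count p n)

count-cong : ∀ {p q} n → (∀ {x} → x < n → p x ≡ q x) → count p n ≡ count q n
count-cong zero    eq = refl
count-cong (suc n) eq rewrite eq (n<1+n n) | count-cong n (λ x<n → eq (m<n⇒m<1+n x<n)) = refl

count-const-true : ∀ n → count (λ _ → true) n ≡ n
count-const-true zero    = refl
count-const-true (suc n) = cong suc (count-const-true n)

count-partition : ∀ (p b : ℕ → Bool) n →
  count p n ≡ count (λ x → p x ∧ b x) n + count (λ x → p x ∧ not (b x)) n
count-partition p b zero = refl
count-partition p b (suc n) with p n | b n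
... | true  | true  = cong suc (count-partition p b n)
... | true  | false = trans (cong suc (count-partition p b n)) (sym (+-suc _ _))
... | false | _     = count-partition p b n

count-monoʳ-≤ : ∀ {p m n} → m ≤ n → count p m ≤ count p n
count-monoʳ-≤ {p} {n = zero}  z≤n = z≤n
count-monoʳ-≤ {p} {m} {suc n} m≤1+n with m≤n⇒m<n∨m≡n m≤1+n
... | inj₂ refl = ≤-refl
... | inj₁ m<1+n with p n
...   | true  = m≤n⇒m≤1+n (count-monoʳ-≤ (m<1+n⇒m≤n m<1+n))
...   | false = count-monoʳ-≤ (m<1+n⇒m≤n m<1+n)

count-<-at : ∀ {p x y} → p x ≡ true → x < y → count p x < count p y
count-<-at {p} {x} px x<y = ≤-trans (≤-reflexive step) (count-monoʳ-≤ x<y)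
  where
  step : suc (count p x) ≡ count p (suc x)
  step rewrite px = refl

count-injective : ∀ {p x y} → p x ≡ true → p y ≡ true → count p x ≡ count p y → x ≡ y
count-injective {x = x} {y} px py eq with <-cmp x y
... | tri< x<y _ _ = contradiction eq (<⇒≢ (count-<-at px x<y))
... | tri≈ _ x≡y _ = x≡y
... | tri> _ _ y<x = contradiction (sym eq) (<⇒≢ (count-<-at py y<x))

count-witness : ∀ {p k} n → suc k ≤ count p n → ∃ λ x → x < n × p x ≡ true × k ≤ count p x
count-witness {p} (suc n) k<c with p n in pn
... | true  = n , n<1+n n , pn , s≤s⁻¹ k<c
... | false with count-witness n k<c
...   | x , x<n , px , k≤ = x , m<n⇒m<1+n x<n , px , k≤

count-pos : ∀ {p x} n → x < n → p x ≡ true → 1 ≤ count p n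
count-pos {p} {x} n x<n px = ≤-trans step (count-monoʳ-≤ x<n)
  where
  step : 1 ≤ count p (suc x)
  step rewrite px = s≤s z≤n

count-≤-injection : ∀ {p q : ℕ → Bool} {N M} (R : ℕ → ℕ → Set)
  → (∀ {x} → x < N → p x ≡ true → ∃ λ y → y < M × q y ≡ true × R x y)
  → (∀ {x x′ y} → x < N → x′ < N → R x y → R x′ y → x ≡ x′)
  → count p N ≤ count q M
count-≤-injection {N = zero} R code inj = z≤n
count-≤-injection {p} {q} {suc N} {M} R code inj with p N in pN
... | false = count-≤-injection R (code ∘ m<n⇒m<1+n) (λ x<N x′<N → inj (m<n⇒m<1+n x<N) (m<n⇒m<1+n x′<N))
... | true with code (n<1+n N) pN
...   | y , y<M , qy , R-N-y = begin
  suc (count p N)                 ≤⟨ s≤s (count-≤-injection R code′ inj′) ⟩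
  suc (count q≢y M)               ≤⟨ +-monoˡ-≤ (count q≢y M) (count-pos M y<M q≡y-at-y) ⟩
  count q≡y M + count q≢y M       ≡⟨ count-partition q (λ z → does (z ≟ y)) M ⟨
  count q M                       ∎
  where
  open ≤-Reasoning
  q≡y q≢y : ℕ → Bool
  q≡y z = q z ∧ does (z ≟ y)
  q≢y z = q z ∧ not (does (z ≟ y))
  q≡y-at-y : q≡y y ≡ true
  q≡y-at-y = cong₂ _∧_ qy (dec-true (y ≟ y) refl)
  code′ : ∀ {x} → x < N → p x ≡ true → ∃ λ y′ → y′ < M × q≢y y′ ≡ true × R x y′
  code′ x<N px with code (m<n⇒m<1+n x<N) px
  ... | y′ , y′<M , qy′ , R-x-y′ =
    y′ , y′<M , cong₂ _∧_ qy′ (cong not (dec-false (y′ ≟ y) y′≢y)) , R-x-y′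
    where
    y′≢y : y′ ≢ y
    y′≢y refl = <⇒≢ x<N (inj (m<n⇒m<1+n x<N) (n<1+n N) R-x-y′ R-N-y)
  inj′ : ∀ {x x′ z} → x < N → x′ < N → R x z → R x′ z → x ≡ x′
  inj′ x<N x′<N = inj (m<n⇒m<1+n x<N) (m<n⇒m<1+n x′<N)

triangle : ℕ → ℕ
triangle zero    = 0
triangle (suc n) = triangle n + suc n

2*triangle : ∀ n → 2 * triangle n ≡ n * suc n
2*triangle zero    = refl
2*triangle (suc n) = begin
  2 * (triangle n + suc n)    ≡⟨ *-distribˡ-+ 2 (triangle n) (suc n) ⟩
  2 * triangle n + 2 * suc n  ≡⟨ cong (_+ 2 * suc n) (2*triangle n) ⟩
  n * suc n + 2 * suc n       ≡⟨ regroup n ⟩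
  suc n * suc (suc n)         ∎
  where
  open ≡-Reasoning
  regroup : ∀ n → n * suc n + 2 * suc n ≡ suc n * suc (suc n)
  regroup = solve-∀

triangle-mono-≤ : ∀ {m n} → m ≤ n → triangle m ≤ triangle n
triangle-mono-≤ {m} {zero} z≤n = ≤-refl
triangle-mono-≤ {m} {suc n} m≤1+n with m≤n⇒m<n∨m≡n m≤1+n
... | inj₁ m<1+n = ≤-trans (triangle-mono-≤ (m<1+n⇒m≤n m<1+n)) (m≤m+n (triangle n) (suc n))
... | inj₂ refl  = ≤-refl

triangle-+-< : ∀ {i j k} → j ≤ i → i < k → triangle i + j < triangle k
triangle-+-< {i} j≤i i<k = ≤-trans (+-monoʳ-< (triangle i) (s≤s j≤i)) (triangle-mono-≤ i<k)

triangle-+-injective : ∀ {i j i′ j′} → j ≤ i → j′ ≤ i′ →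
  triangle i + j ≡ triangle i′ + j′ → i ≡ i′ × j ≡ j′
triangle-+-injective {i} {j} {i′} {j′} j≤i j′≤i′ eq with <-cmp i i′
... | tri< i<i′ _ _ = contradiction eq (<⇒≢ (≤-trans (triangle-+-< j≤i i<i′) (m≤m+n _ j′)))
... | tri≈ _ refl _ = refl , +-cancelˡ-≡ (triangle i) j j′ eq
... | tri> _ _ i′<i = contradiction (sym eq) (<⇒≢ (≤-trans (triangle-+-< j′≤i′ i′<i) (m≤m+n _ j)))

m*[m∸1]<n*[1+n]⇒m≤n : ∀ {a k} → a * (a ∸ 1) < k * suc k → a ≤ k
m*[m∸1]<n*[1+n]⇒m≤n {a} {k} lt with a ≤? k
... | yes a≤k = a≤k
... | no  a≰k = contradiction lt (≤⇒≯ (begin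
  k * suc k       ≤⟨ *-mono-≤ (∸-monoˡ-≤ 1 k<a) k<a ⟩
  (a ∸ 1) * a     ≡⟨ *-comm (a ∸ 1) a ⟩
  a * (a ∸ 1)     ∎))
  where
  open ≤-Reasoning
  k<a = ≰⇒> a≰k

<∸1⇒suc< : ∀ {r n} → r < n ∸ 1 → suc r < n
<∸1⇒suc< {n = suc n} r<n = s≤s r<n

+suc*-∸ : ∀ y j m → y + suc j * m ∸ m ≡ y + j * m
+suc*-∸ y j m = trans (cong (_∸ m) (regroup y j m)) (m+n∸n≡m (y + j * m) m)
  where
  regroup : ∀ y j m → y + suc j * m ≡ y + j * m + m
  regroup = solve-∀

bool-absurd : ∀ {A : Set} {b} → b ≡ true → b ≡ false → A
bool-absurd refl ()

∧-true⁻ : ∀ {a b} → a ∧ b ≡ true → a ≡ true × b ≡ true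
∧-true⁻ {true} b≡true = refl , b≡true

any-upTo⁻ : ∀ (P : ℕ → Bool) n → any P (upTo n) ≡ true → ∃ λ a → a < n × P a ≡ true
any-upTo⁻ P n anyP with find (any⁻ P (upTo n) (Equivalence.from T-≡ anyP))
... | a , a∈upTo , Pa = a , ∈-upTo⁻ a∈upTo , Equivalence.to T-≡ Pa

≡ᵇ0-false : ∀ {x} → 0 < x → (x ≡ᵇ 0) ≡ false
≡ᵇ0-false {suc _} _ = refl

module _ (S : NumericalSemigroup) where

  splits : ℕ → ℕ → Bool
  splits s a = not (a ≡ᵇ 0) ∧ mem S a ∧ mem S (s ∸ a)

  splits-true⁻ : ∀ {s} a → splits s a ≡ true → 0 < a × mem S a ≡ true × mem S (s ∸ a) ≡ true
  splits-true⁻ (suc a) split = s≤s z≤n , ∧-true⁻ split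

  isMinGen-unfold : ∀ {s} → mem S s ≡ true → 0 < s → isMinGen S s ≡ not (any (splits s) (upTo s))
  isMinGen-unfold ms 0<s rewrite ms | ≡ᵇ0-false 0<s = refl

  isMinGen-intro : ∀ {s} → mem S s ≡ true → 0 < s →
    (∀ {a} → a < s → 0 < a → mem S a ≡ true → mem S (s ∸ a) ≡ false) → isMinGen S s ≡ true
  isMinGen-intro {s} ms 0<s indecomposable = trans (isMinGen-unfold ms 0<s) (cong not no-split)
    where
    no-split : any (splits s) (upTo s) ≡ false
    no-split with any (splits s) (upTo s) in anySplits
    ... | false = refl
    ... | true with any-upTo⁻ (splits s) s anySplits
    ...   | a , a<s , split with splits-true⁻ a split
    ...     | 0<a , ma , ms∸a = bool-absurd ms∸a (indecomposable a<s 0<a ma)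

  isMinGen-elim : ∀ {s} → mem S s ≡ true → 0 < s → isMinGen S s ≡ false →
    ∃ λ a → a < s × 0 < a × mem S a ≡ true × mem S (s ∸ a) ≡ true
  isMinGen-elim {s} ms 0<s notGen =
    let a , a<s , split = any-upTo⁻ (splits s) s (not-injective (trans (sym (isMinGen-unfold ms 0<s)) notGen))
    in  a , a<s , splits-true⁻ a split

module Apery (S : NumericalSemigroup) {m : ℕ} (multiplicity : IsMultiplicity S m) where

  private
    0<m : 0 < m
    0<m = proj₁ multiplicity

    instance
      m-nonZero : NonZero m
      m-nonZero = >-nonZero 0<m

  -- Truncated subtraction gives 0 ∸ m = 0 ∈ S, so 0 is excluded: this is Ap(S, m) ∖ {0}.
  apery : ℕ → Bool
  apery x = mem S x ∧ not (mem S (x ∸ m))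

  apery-mem : ∀ {x} → apery x ≡ true → mem S x ≡ true
  apery-mem ax = proj₁ (∧-true⁻ ax)

  apery-∸ : ∀ {x} → apery x ≡ true → mem S (x ∸ m) ≡ false
  apery-∸ ax = not-injective (proj₂ (∧-true⁻ ax))

  apery-intro : ∀ {x} → mem S x ≡ true → mem S (x ∸ m) ≡ false → apery x ≡ true
  apery-intro mx mx∸m rewrite mx | mx∸m = refl

  apery-false : ∀ {x} → mem S (x ∸ m) ≡ true → apery x ≡ false
  apery-false {x} mx∸m rewrite mx∸m = ∧-zeroʳ (mem S x)

  mem-<m : ∀ {x} → 0 < x → x < m → mem S x ≡ false
  mem-<m {x} = proj₂ (proj₂ multiplicity) x

  m-mem : mem S m ≡ true
  m-mem = proj₁ (proj₂ multiplicity)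

  *m-mem : ∀ j → mem S (j * m) ≡ true
  *m-mem zero    = zero∈ S
  *m-mem (suc j) = closed S m (j * m) m-mem (*m-mem j)

  +*m-mem : ∀ {y} j → mem S y ≡ true → mem S (y + j * m) ≡ true
  +*m-mem {y} j my = closed S y (j * m) my (*m-mem j)

  mem⇒≥m : ∀ {x} → mem S x ≡ true → 0 < x → m ≤ x
  mem⇒≥m {x} mx 0<x with m ≤? x
  ... | yes m≤x = m≤x
  ... | no  m≰x = bool-absurd mx (mem-<m 0<x (≰⇒> m≰x))

  apery⇒≥m : ∀ {x} → apery x ≡ true → m ≤ x
  apery⇒≥m {x} ax with m ≤? x
  ... | yes m≤x = m≤x
  ... | no  m≰x = bool-absurd (zero∈ S) 0∈S
    where
    0∈S : mem S 0 ≡ false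
    0∈S = subst (λ z → mem S z ≡ false) (m≤n⇒m∸n≡0 (<⇒≤ (≰⇒> m≰x))) (apery-∸ ax)

  apery-+suc*m : ∀ {y} j → mem S y ≡ true → apery (y + suc j * m) ≡ false
  apery-+suc*m {y} j my = apery-false (subst (λ z → mem S z ≡ true) (sym (+suc*-∸ y j m)) (+*m-mem j my))

  apery-minimal : ∀ {x y} → apery x ≡ true → mem S y ≡ true → x % m ≡ y % m → x ≤ y
  apery-minimal {x} {y} ax my x≡y with x / m ≤? y / m
  ... | yes i≤j = begin
    x                 ≡⟨ m≡m%n+[m/n]*n x m ⟩
    x % m + x / m * m ≤⟨ +-mono-≤ (≤-reflexive x≡y) (*-monoˡ-≤ m i≤j) ⟩
    y % m + y / m * m ≡⟨ m≡m%n+[m/n]*n y m ⟨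
    y                 ∎
    where open ≤-Reasoning
  ... | no i≰j with m≤n⇒∃[o]m+o≡n (≰⇒> i≰j)
  ...   | d , 1+j+d≡i = bool-absurd ax (subst (λ z → apery z ≡ false) (sym x≡y+) (apery-+suc*m d my))
    where
    shift : ∀ r j d m → r + (suc j + d) * m ≡ r + j * m + suc d * m
    shift = solve-∀
    x≡y+ : x ≡ y + suc d * m
    x≡y+ = begin
      x                         ≡⟨ m≡m%n+[m/n]*n x m ⟩
      x % m + x / m * m         ≡⟨ cong₂ (λ r i → r + i * m) x≡y (sym 1+j+d≡i) ⟩
      y % m + (suc (y / m) + d) * m ≡⟨ shift (y % m) (y / m) d m ⟩
      y % m + y / m * m + suc d * m ≡⟨ cong (_+ suc d * m) (m≡m%n+[m/n]*n y m) ⟨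
      y + suc d * m             ∎
      where open ≡-Reasoning

  apery-unique : ∀ {x y} → apery x ≡ true → apery y ≡ true → x % m ≡ y % m → x ≡ y
  apery-unique ax ay x≡y = ≤-antisym (apery-minimal ax (apery-mem ay) x≡y) (apery-minimal ay (apery-mem ax) (sym x≡y))

  apery-residue≢0 : ∀ {x} → apery x ≡ true → x % m ≢ 0
  apery-residue≢0 ax x%m≡0 =
    <⇒≱ 0<m (≤-trans (apery⇒≥m ax) (apery-minimal ax (zero∈ S) (trans x%m≡0 (sym (m*n%n≡0 0 m)))))

  apery-of-residue : ∀ {r} → 0 < r → r < m → ∃ λ x → apery x ≡ true × x % m ≡ r
  apery-of-residue {r} 0<r r<m = descend N (cofinite S .proj₂ (r + N * m) N≤r+N*m)
    where
    N = cofinite S .proj₁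
    N≤r+N*m : N ≤ r + N * m
    N≤r+N*m = ≤-trans (m≤m*n N m) (m≤n+m (N * m) r)
    descend : ∀ j → mem S (r + j * m) ≡ true → ∃ λ x → apery x ≡ true × x % m ≡ r
    descend zero    mr = bool-absurd mr (trans (cong (mem S) (+-identityʳ r)) (mem-<m 0<r r<m))
    descend (suc j) mx with mem S (r + j * m) in mx′
    ... | true  = descend j mx′
    ... | false = r + suc j * m
                , apery-intro mx (trans (cong (mem S) (+suc*-∸ r j m)) mx′)
                , trans ([m+kn]%n≡m%n r (suc j) m) (m<n⇒m%n≡m r<m)

  apery-summand : ∀ {a b} → mem S a ≡ true → m ≤ a → mem S b ≡ true → apery (a + b) ≡ true → apery a ≡ true
  apery-summand {a} {b} ma m≤a mb aab = apery-intro ma a∸m∉S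
    where
    a∸m∉S : mem S (a ∸ m) ≡ false
    a∸m∉S with mem S (a ∸ m) in ma∸m
    ... | false = refl
    ... | true  = bool-absurd (trans (cong (mem S) (+-∸-comm b m≤a)) (closed S _ b ma∸m mb)) (apery-∸ aab)

  apery-split : ∀ {w} → apery w ≡ true → isMinGen S w ≡ false →
    ∃₂ λ a b → apery a ≡ true × apery b ≡ true × a + b ≡ w
  apery-split {w} aw notGen with isMinGen-elim S (apery-mem aw) (≤-trans 0<m (apery⇒≥m aw)) notGen
  ... | a , a<w , 0<a , ma , mb = a , w ∸ a , aa , ab , a+b≡w
    where
    a+b≡w = m+[n∸m]≡n (<⇒≤ a<w)
    0<b : 0 < w ∸ a
    0<b = m<n⇒0<n∸m a<w
    aa = apery-summand ma (mem⇒≥m ma 0<a) mb (subst (λ z → apery z ≡ true) (sym a+b≡w) aw)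
    ab = apery-summand mb (mem⇒≥m mb 0<b) ma (subst (λ z → apery z ≡ true) (trans (sym a+b≡w) (+-comm a (w ∸ a))) aw)

  m-isMinGen : isMinGen S m ≡ true
  m-isMinGen = isMinGen-intro S m-mem 0<m λ a<m 0<a ma → bool-absurd ma (mem-<m 0<a a<m)

  apery-*m : ∀ j → apery (j * m) ≡ false
  apery-*m zero    = apery-false (subst (λ z → mem S z ≡ true) (sym (0∸n≡0 m)) (zero∈ S))
  apery-*m (suc j) = apery-+suc*m j (zero∈ S)

  same-class : ∀ {y z} i j → y + i * m ≡ z + j * m → y % m ≡ z % m
  same-class {y} {z} i j eq = trans (sym ([m+kn]%n≡m%n y i m)) (trans (cong (_% m) eq) ([m+kn]%n≡m%n z j m))

  nonApery : ℕ → Bool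
  nonApery x = mem S x ∧ not (apery x)

  divisible : ℕ → Bool
  divisible x = does (x % m ≟ 0)

  apery+suc*m-nonApery∧¬divisible : ∀ {y} → apery y ≡ true → ∀ t →
    (nonApery (y + suc t * m) ∧ not (divisible (y + suc t * m))) ≡ true
  apery+suc*m-nonApery∧¬divisible {y} ay t =
    cong₂ _∧_ (cong₂ _∧_ (+*m-mem (suc t) (apery-mem ay)) (cong not (apery-+suc*m t (apery-mem ay))))
              (cong not (dec-false (_ ≟ 0) (apery-residue≢0 ay ∘ trans (sym ([m+kn]%n≡m%n y (suc t) m)))))

  nonGenerator : ℕ → Bool
  nonGenerator x = apery x ∧ not (isMinGen S x)

  nonGenerator-apery : ∀ {x} → nonGenerator x ≡ true → apery x ≡ true
  nonGenerator-apery nx = proj₁ (∧-true⁻ nx)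

  nonGenerator-split : ∀ {x} → nonGenerator x ≡ true →
    ∃₂ λ a b → apery a ≡ true × apery b ≡ true × a + b ≡ x
  nonGenerator-split nx = apery-split (nonGenerator-apery nx) (not-injective (proj₂ (∧-true⁻ nx)))

module Counting (S : NumericalSemigroup) {m : ℕ} (multiplicity : IsMultiplicity S m)
                {f : ℕ} (frobenius : IsFrobenius S f) where

  open Apery S multiplicity

  private
    instance
      m-nonZero : NonZero m
      m-nonZero = >-nonZero (proj₁ multiplicity)

  mem⇒≢f : ∀ {x} → mem S x ≡ true → x ≢ f
  mem⇒≢f mx refl = bool-absurd mx (proj₁ frobenius)

  mem-≤f⇒<f : ∀ {x} → mem S x ≡ true → x ≤ f → x < f
  mem-≤f⇒<f mx x≤f = ≤∧≢⇒< x≤f (mem⇒≢f mx)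

  ∉S⇒≤f : ∀ {x} → mem S x ≡ false → x ≤ f
  ∉S⇒≤f {x} x∉S with x ≤? f
  ... | yes x≤f = x≤f
  ... | no  x≰f = bool-absurd (proj₂ frobenius x (≰⇒> x≰f)) x∉S

  apery⇒≤f+m : ∀ {x} → apery x ≡ true → x ≤ f + m
  apery⇒≤f+m {x} ax = begin
    x           ≡⟨ m∸n+n≡m (apery⇒≥m ax) ⟨
    x ∸ m + m   ≤⟨ +-monoˡ-≤ m (∉S⇒≤f (apery-∸ ax)) ⟩
    f + m       ∎
    where open ≤-Reasoning

  apery-summand<f : ∀ {a b} → apery a ≡ true → apery b ≡ true → apery (a + b) ≡ true → a < f
  apery-summand<f {a} {b} aa ab aab = mem-≤f⇒<f (apery-mem aa) (begin
    a               ≤⟨ m≤m+n a (b ∸ m) ⟩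
    a + (b ∸ m)     ≡⟨ +-∸-assoc a (apery⇒≥m ab) ⟨
    a + b ∸ m       ≤⟨ ∉S⇒≤f (apery-∸ aab) ⟩
    f               ∎)
    where open ≤-Reasoning

  residues≤apery : m ∸ 1 ≤ count apery (suc (f + m))
  residues≤apery = begin
    m ∸ 1                       ≡⟨ count-const-true (m ∸ 1) ⟨
    count (λ _ → true) (m ∸ 1)  ≤⟨ count-≤-injection (λ r x → x % m ≡ suc r) representative
                                     (λ _ _ x≡r x≡r′ → suc-injective (trans (sym x≡r) x≡r′)) ⟩
    count apery (suc (f + m))   ∎
    where
    open ≤-Reasoning
    representative : ∀ {r} → r < m ∸ 1 → true ≡ true →
      ∃ λ x → x < suc (f + m) × apery x ≡ true × x % m ≡ suc r
    representative r<m∸1 _ with apery-of-residue (s≤s z≤n) (<∸1⇒suc< r<m∸1)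
    ... | x , ax , x%m = x , s≤s (apery⇒≤f+m ax) , ax , x%m

  aperyGenerators<embDim : count (λ x → apery x ∧ isMinGen S x) (suc (f + m)) < embDim S f m
  aperyGenerators<embDim = begin-strict
    G                                                         <⟨ m<m+n G (count-pos N m<N m-gen∧¬ap) ⟩
    G + count gen∧¬ap N                                       ≡⟨ cong (_+ count gen∧¬ap N) G≡ ⟩
    count (λ x → isMinGen S x ∧ apery x) N + count gen∧¬ap N  ≡⟨ count-partition (isMinGen S) apery N ⟨
    count (isMinGen S) N                                      ≡⟨ length-filter-upTo (isMinGen S) N ⟨
    embDim S f m                                              ∎
    where
    open ≤-Reasoning
    N = suc (f + m)
    G = count (λ x → apery x ∧ isMinGen S x) N
    G≡ : G ≡ count (λ x → isMinGen S x ∧ apery x) N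
    G≡ = count-cong N λ {x} _ → ∧-comm (apery x) (isMinGen S x)
    gen∧¬ap : ℕ → Bool
    gen∧¬ap x = isMinGen S x ∧ not (apery x)
    m<N : m < N
    m<N = s≤s (m≤n+m m f)
    m-gen∧¬ap : gen∧¬ap m ≡ true
    m-gen∧¬ap = cong₂ _∧_ m-isMinGen (cong not (apery-false m∸m∈S))
      where
      m∸m∈S : mem S (m ∸ m) ≡ true
      m∸m∈S = subst (λ z → mem S z ≡ true) (sym (n∸n≡0 m)) (zero∈ S)


  m≤embDim+nonGenerators : m ≤ embDim S f m + count nonGenerator (suc (f + m))
  m≤embDim+nonGenerators = begin
    m                                        ≤⟨ m≤n+m∸n m 1 ⟩
    suc (m ∸ 1)                              ≤⟨ s≤s residues≤apery ⟩
    suc (count apery N)                      ≡⟨ cong suc (count-partition apery (isMinGen S) N) ⟩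
    suc (count (λ x → apery x ∧ isMinGen S x) N + count nonGenerator N)
                                             ≤⟨ +-monoˡ-≤ (count nonGenerator N) aperyGenerators<embDim ⟩
    embDim S f m + count nonGenerator N      ∎
    where
    open ≤-Reasoning
    N = suc (f + m)

  -- x = a + b with a ≤ b in Ap is coded by the pair rank a ≤ rank b, numbered triangularly.
  nonGenerators≤triangle : count nonGenerator (suc (f + m)) ≤ triangle (count apery f)
  nonGenerators≤triangle = begin
    count nonGenerator (suc (f + m))  ≤⟨ count-≤-injection Code code (λ _ _ → Code-injective) ⟩
    count (λ _ → true) (triangle k)   ≡⟨ count-const-true (triangle k) ⟩
    triangle k                        ∎
    where
    open ≤-Reasoning
    k = count apery f
    rank = count apery
    Code : ℕ → ℕ → Set
    Code x y = ∃₂ λ a b → apery a ≡ true × apery b ≡ true × a ≤ b × a + b ≡ x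
                        × triangle (rank b) + rank a ≡ y
    code-of-sum : ∀ {a b x} → apery a ≡ true → apery b ≡ true → a ≤ b → a + b ≡ x → apery x ≡ true →
      ∃ λ y → y < triangle k × true ≡ true × Code x y
    code-of-sum {a} {b} aa ab a≤b a+b≡x ax =
      _ , triangle-+-< (count-monoʳ-≤ a≤b) (count-<-at ab b<f) , refl , a , b , aa , ab , a≤b , a+b≡x , refl
      where
      b<f : b < f
      b<f = apery-summand<f ab aa (subst (λ z → apery z ≡ true) (sym (trans (+-comm b a) a+b≡x)) ax)
    code : ∀ {x} → x < suc (f + m) → nonGenerator x ≡ true → ∃ λ y → y < triangle k × true ≡ true × Code x y
    code _ nx with nonGenerator-split nx
    ... | a , b , aa , ab , a+b≡x with ≤-total a b
    ...   | inj₁ a≤b = code-of-sum aa ab a≤b a+b≡x (nonGenerator-apery nx)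
    ...   | inj₂ b≤a = code-of-sum ab aa b≤a (trans (+-comm b a) a+b≡x) (nonGenerator-apery nx)
    Code-injective : ∀ {x x′ y} → Code x y → Code x′ y → x ≡ x′
    Code-injective (a , b , aa , ab , a≤b , refl , refl) (a′ , b′ , aa′ , ab′ , a′≤b′ , refl , eq)
      with triangle-+-injective (count-monoʳ-≤ a≤b) (count-monoʳ-≤ a′≤b′) (sym eq)
    ... | rank-b≡ , rank-a≡ =
      cong₂ _+_ (count-injective {apery} aa aa′ rank-a≡) (count-injective {apery} ab ab′ rank-b≡)

  record AperyPair : Set where
    field
      a b     : ℕ
      apery-a : apery a ≡ true
      apery-b : apery b ≡ true
      a≢b     : a ≢ b
      a+b≤f+m : a + b ≤ f + m

  aperyPair-of-sums : ∀ {a b a′ b′} → apery a ≡ true → apery b ≡ true → apery a′ ≡ true → apery b′ ≡ true →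
    a + b < a′ + b′ → apery (a′ + b′) ≡ true → AperyPair
  aperyPair-of-sums {a} {b} {a′} {b′} aa ab aa′ ab′ x<y ay with a ≟ b | a′ ≟ b′
  ... | no a≢b   | _          = record { apery-a = aa ; apery-b = ab ; a≢b = a≢b
                                       ; a+b≤f+m = <⇒≤ (<-≤-trans x<y (apery⇒≤f+m ay)) }
  ... | yes _    | no a′≢b′   = record { apery-a = aa′ ; apery-b = ab′ ; a≢b = a′≢b′
                                       ; a+b≤f+m = apery⇒≤f+m ay }
  ... | yes refl | yes refl   = record { apery-a = aa ; apery-b = aa′ ; a≢b = <⇒≢ a<a′
                                       ; a+b≤f+m = ≤-trans (+-monoˡ-≤ a′ (<⇒≤ a<a′)) (apery⇒≤f+m ay) }
    where
    a<a′ : a < a′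
    a<a′ = ≰⇒> λ a′≤a → <⇒≱ x<y (+-mono-≤ a′≤a a′≤a)

  two-nonGenerators⇒aperyPair : 2 ≤ count nonGenerator (suc (f + m)) → AperyPair
  two-nonGenerators⇒aperyPair two with count-witness (suc (f + m)) two
  ... | y , _ , ny , one with count-witness y one
  ...   | x , x<y , nx , _ with nonGenerator-split nx | nonGenerator-split ny
  ...     | a , b , aa , ab , refl | a′ , b′ , aa′ , ab′ , refl =
    aperyPair-of-sums aa ab aa′ ab′ x<y (nonGenerator-apery ny)

  suc*m≤f+m⇒*m≤f : ∀ j → suc j * m ≤ f + m → j * m ≤ f
  suc*m≤f+m⇒*m≤f j le = +-cancelˡ-≤ m (j * m) f (≤-trans le (≤-reflexive (+-comm f m)))

  multiples≤ : ∀ {q} → q * m ≤ f + m → q ≤ count (λ x → nonApery x ∧ divisible x) f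
  multiples≤ {q} qm≤f+m = begin
    q                                         ≡⟨ count-const-true q ⟨
    count (λ _ → true) q                      ≤⟨ count-≤-injection (λ j x → x ≡ j * m) multiple
                                                   (λ _ _ x≡ x≡′ → *-cancelʳ-≡ _ _ m (trans (sym x≡) x≡′)) ⟩
    count (λ x → nonApery x ∧ divisible x) f  ∎
    where
    open ≤-Reasoning
    multiple : ∀ {j} → j < q → true ≡ true → ∃ λ x → x < f × (nonApery x ∧ divisible x) ≡ true × x ≡ j * m
    multiple {j} j<q _ =
      j * m , jm<f , cong₂ _∧_ (cong₂ _∧_ (*m-mem j) (cong not (apery-*m j))) (dec-true (_ ≟ 0) (m*n%n≡0 j m)) , refl
      where
      jm<f : j * m < f
      jm<f = mem-≤f⇒<f (*m-mem j) (suc*m≤f+m⇒*m≤f j (≤-trans (*-monoˡ-≤ m j<q) qm≤f+m))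

  -- Index j < c picks a + (1+j)m if that lies below f, and b + (c−j)m otherwise;
  -- a + b ≤ f + m keeps the latter below f.
  pairClasses≤ : AperyPair → ∀ {c} → (2 + c) * m ≤ f → c ≤ count (λ x → nonApery x ∧ not (divisible x)) f
  pairClasses≤ pair {c} [2+c]m≤f = begin
    c                                               ≡⟨ count-const-true c ⟨
    count (λ _ → true) c                            ≤⟨ count-≤-injection Member member member-injective ⟩
    count (λ x → nonApery x ∧ not (divisible x)) f  ∎
    where
    open ≤-Reasoning
    open AperyPair pair
    Member : ℕ → ℕ → Set
    Member j x = x ≡ a + suc j * m ⊎ x ≡ b + suc (c ∸ suc j) * m
    b-below-f : ∀ {j} → j < c → f ≤ a + suc j * m → b + suc (c ∸ suc j) * m < f
    b-below-f {j} j<c f≤ = +-cancelˡ-< f _ f (begin-strict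
      f + Y                                 <⟨ +-monoˡ-< Y (≤∧≢⇒< f≤ (mem⇒≢f A∈S ∘ sym)) ⟩
      a + suc j * m + Y                     ≡⟨ regroup a b j (c ∸ suc j) m ⟩
      a + b + suc (suc j + (c ∸ suc j)) * m ≡⟨ cong (λ i → a + b + suc i * m) (m+[n∸m]≡n j<c) ⟩
      a + b + suc c * m                     ≤⟨ +-monoˡ-≤ (suc c * m) a+b≤f+m ⟩
      f + m + suc c * m                     ≡⟨ +-assoc f m (suc c * m) ⟩
      f + (2 + c) * m                       ≤⟨ +-monoʳ-≤ f [2+c]m≤f ⟩
      f + f                                 ∎)
      where
      Y = b + suc (c ∸ suc j) * m
      A∈S : mem S (a + suc j * m) ≡ true
      A∈S = +*m-mem (suc j) (apery-mem apery-a)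
      regroup : ∀ a b j t m → a + suc j * m + (b + suc t * m) ≡ a + b + suc (suc j + t) * m
      regroup = solve-∀
    member : ∀ {j} → j < c → true ≡ true →
      ∃ λ x → x < f × (nonApery x ∧ not (divisible x)) ≡ true × Member j x
    member {j} j<c _ with a + suc j * m <? f
    ... | yes below = _ , below , apery+suc*m-nonApery∧¬divisible apery-a j , inj₁ refl
    ... | no  above = _ , b-below-f j<c (≮⇒≥ above) , apery+suc*m-nonApery∧¬divisible apery-b (c ∸ suc j) , inj₂ refl
    member-injective : ∀ {j j′ x} → j < c → j′ < c → Member j x → Member j′ x → j ≡ j′
    member-injective _ _ (inj₁ refl) (inj₁ eq) = suc-injective (*-cancelʳ-≡ _ _ m (+-cancelˡ-≡ a _ _ eq))
    member-injective j<c j′<c (inj₂ refl) (inj₂ eq) =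
      suc-injective (∸-cancelˡ-≡ j<c j′<c (suc-injective (*-cancelʳ-≡ _ _ m (+-cancelˡ-≡ b _ _ eq))))
    member-injective {j} {j′} _ _ (inj₁ refl) (inj₂ eq) =
      contradiction (apery-unique apery-a apery-b (same-class (suc j) (suc (c ∸ suc j′)) eq)) a≢b
    member-injective {j} {j′} _ _ (inj₂ refl) (inj₁ eq) =
      contradiction (apery-unique apery-a apery-b (same-class (suc j′) (suc (c ∸ suc j)) (sym eq))) a≢b

  leftCount-lowerBound : AperyPair → ∀ {q} → q * m ≤ f + m → 2 * q + count apery f ≤ leftCount S f + 3
  leftCount-lowerBound pair {q} qm≤f+m = begin
    2 * q + k                                    ≤⟨ rearrange k q ⟩
    k + (q + (q ∸ 3)) + 3
      ≤⟨ +-monoˡ-≤ 3 (+-monoʳ-≤ k (+-mono-≤ (multiples≤ qm≤f+m) (classes≤ q qm≤f+m))) ⟩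
    k + (count (λ x → nonApery x ∧ divisible x) f + count (λ x → nonApery x ∧ not (divisible x)) f) + 3
      ≡⟨ cong (_+ 3) (cong₂ _+_ (count-cong f λ _ → mem∧apery≡apery) (count-partition nonApery divisible f)) ⟨
    count (λ x → mem S x ∧ apery x) f + count nonApery f + 3 ≡⟨ cong (_+ 3) (count-partition (mem S) apery f) ⟨
    count (mem S) f + 3                          ≡⟨ cong (_+ 3) (length-filter-upTo (mem S) f) ⟨
    leftCount S f + 3                            ∎
    where
    open ≤-Reasoning
    k = count apery f
    rearrange : ∀ k q → 2 * q + k ≤ k + (q + (q ∸ 3)) + 3
    rearrange k q = begin
      2 * q + k                  ≡⟨ lhs k q ⟩
      k + (q + q)                ≤⟨ +-monoʳ-≤ k (+-monoʳ-≤ q (m≤n+m∸n q 3)) ⟩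
      k + (q + (3 + (q ∸ 3)))    ≡⟨ rhs k q (q ∸ 3) ⟩
      k + (q + (q ∸ 3)) + 3      ∎
      where
      lhs : ∀ k q → 2 * q + k ≡ k + (q + q)
      lhs = solve-∀
      rhs : ∀ k q c → k + (q + (3 + c)) ≡ k + (q + c) + 3
      rhs = solve-∀
    mem∧apery≡apery : ∀ {x} → mem S x ∧ apery x ≡ apery x
    mem∧apery≡apery {x} = trans (sym (∧-assoc (mem S x) (mem S x) (not (mem S (x ∸ m)))))
                                (cong (_∧ not (mem S (x ∸ m))) (∧-idem (mem S x)))
    classes≤ : ∀ q → q * m ≤ f + m → q ∸ 3 ≤ count (λ x → nonApery x ∧ not (divisible x)) f
    classes≤ 0 _ = z≤n
    classes≤ 1 _ = z≤n
    classes≤ 2 _ = z≤n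
    classes≤ (suc (suc (suc c))) qm≤f+m = pairClasses≤ pair (suc*m≤f+m⇒*m≤f (2 + c) qm≤f+m)

corollary1 : (S : NumericalSemigroup) (f m q ρ α : ℕ)
    → IsFrobenius S f
    → IsMultiplicity S m
    → f + 1 + ρ ≡ q * m
    → ρ ≤ m ∸ 1
    → 2 * embDim S f m + α * (α ∸ 1) < 2 * m
    → 1 < α
    → α < m ∸ 1
    → q * m + 3 * embDim S f m ≤ (2 * q + α) * embDim S f m
    → f + 1 ≤ embDim S f m * leftCount S f
corollary1 S f m q ρ α frobenius multiplicity f+1+ρ≡qm ρ≤m∸1 few-generators 1<α _ wilf-hypothesis = begin
  f + 1      ≤⟨ m≤m+n (f + 1) ρ ⟩
  f + 1 + ρ  ≡⟨ f+1+ρ≡qm ⟩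
  q * m      ≤⟨ +-cancelʳ-≤ (3 * ν) (q * m) (n * ν) qm+3ν≤nν+3ν ⟩
  n * ν      ≡⟨ *-comm n ν ⟩
  ν * n      ∎
  where
  open ≤-Reasoning
  open Apery S multiplicity
  open Counting S multiplicity frobenius
  ν = embDim S f m
  n = leftCount S f
  k = count apery f
  D = count nonGenerator (suc (f + m))
  α*[α∸1]<2*D : α * (α ∸ 1) < 2 * D
  α*[α∸1]<2*D = +-cancelˡ-< (2 * ν) _ _ (<-≤-trans few-generators
    (≤-trans (*-monoʳ-≤ 2 m≤embDim+nonGenerators) (≤-reflexive (*-distribˡ-+ 2 ν D))))
  α≤k : α ≤ k
  α≤k = m*[m∸1]<n*[1+n]⇒m≤n (<-≤-trans α*[α∸1]<2*D
    (≤-trans (*-monoʳ-≤ 2 nonGenerators≤triangle) (≤-reflexive (2*triangle k))))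
  2≤D : 2 ≤ D
  2≤D = *-cancelˡ-< 2 1 D (≤-<-trans (*-mono-≤ 1<α (∸-monoˡ-≤ 1 1<α)) α*[α∸1]<2*D)
  qm≤f+m : q * m ≤ f + m
  qm≤f+m = subst (_≤ f + m) f+1+ρ≡qm (≤-trans (≤-reflexive (+-assoc f 1 ρ))
    (+-monoʳ-≤ f (≤-trans (s≤s ρ≤m∸1) (≤-reflexive (m+[n∸m]≡n (proj₁ multiplicity))))))
  2q+α≤n+3 : 2 * q + α ≤ n + 3
  2q+α≤n+3 = ≤-trans (+-monoʳ-≤ (2 * q) α≤k) (leftCount-lowerBound (two-nonGenerators⇒aperyPair 2≤D) {q} qm≤f+m)
  qm+3ν≤nν+3ν : q * m + 3 * ν ≤ n * ν + 3 * ν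
  qm+3ν≤nν+3ν = ≤-trans wilf-hypothesis (≤-trans (*-monoˡ-≤ ν 2q+α≤n+3) (≤-reflexive (*-distribʳ-+ ν n 3)))
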